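{- Let $\gamma$ be the morphism on $\{a,b,c\}^*$ given by $a\mapsto aca$, $b\mapsto cab$, $c\mapsto b$ (extended to the free group on $\{a,b,c\}$). Define $p_{ -1}=a^{ -1}$, $p_0=b$, and $p_{k+1}=\gamma(ca\,p_k)$ for each $k\ge 0$. Then for all $k\ge 0$: (i) $p_{k+1}=p_k\,aca\,p_{k-1}\,aca\,p_k$; (ii) $p_k$ is a palindrome; (iii) $p_{k-1}\,aca\,p_k$ is not a palindrome.
   Context: Computations are in the free group on $\{a,b,c\}$; e.g. $p_1=\gamma(cab)=bacacab$ and $p_{ -1}\,aca\,p_0=a^{ -1}acab=cab$. For $k\ge0$ all $p_k$ are (nonempty) words. A palindrome is a word equal to its reversal. -}

module Defs where

open import Data.Bool using (Bool; true; false; not; _∧_; if_then_else_)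
open import Data.List using (List; []; _∷_; _++_; foldr; reverse; concatMap; map)
open import Data.Product using (_×_; _,_)
open import Data.Nat using (ℕ; zero; suc)
open import Relation.Binary.PropositionalEquality using (_≡_)

data Letter : Set where
  a b c : Letter

_==ᴸ_ : Letter → Letter → Bool
a ==ᴸ a = true
b ==ᴸ b = true
c ==ᴸ c = true
_ ==ᴸ _ = false

-- A symbol is a generator with an exponent sign: (x , true) = x, (x , false) = x⁻¹
Sym : Set
Sym = Letter × Bool

Word : Set
Word = List Sym

cancels : Sym → Sym → Bool
cancels (x , s) (y , t) = (x ==ᴸ y) ∧ not (s ==ᴮ t)
  where
  _==ᴮ_ : Bool → Bool → Bool
  true ==ᴮ true = true
  false ==ᴮ false = true
  _ ==ᴮ _ = false

push : Sym → Word → Word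
push x [] = x ∷ []
push x (y ∷ ys) = if cancels x y then ys else x ∷ y ∷ ys

reduce : Word → Word
reduce = foldr push []

-- Elements of the free group are represented by reduced words;
-- the group product is concatenation followed by free reduction.
_·_ : Word → Word → Word
u · v = reduce (u ++ v)
infixl 6 _·_

inv : Word → Word
inv w = reverse (map (λ { (x , s) → (x , not s) }) w)

ᵃ ᵇ ᶜ : Word
ᵃ = (a , true) ∷ []
ᵇ = (b , true) ∷ []
ᶜ = (c , true) ∷ []

γgen : Letter → Word
γgen a = (a , true) ∷ (c , true) ∷ (a , true) ∷ []
γgen b = (c , true) ∷ (a , true) ∷ (b , true) ∷ []
γgen c = (b , true) ∷ []

γsym : Sym → Word
γsym (x , true) = γgen x
γsym (x , false) = inv (γgen x)

γ : Word → Word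
γ w = reduce (concatMap γsym w)

aca : Word
aca = (a , true) ∷ (c , true) ∷ (a , true) ∷ []

p : ℕ → Word
p zero = ᵇ
p (suc k) = γ (ᶜ · ᵃ · p k)

-- pPrev k = p_{k-1} for k ≥ 0 :  p_{-1} = a⁻¹
pPrev : ℕ → Word
pPrev zero = (a , false) ∷ []
pPrev (suc k) = p k

Palindrome : Word → Set
Palindrome w = reverse w ≡ w

-- All p_k with k ≥ 0 are positive words, and on positive words the free-group
-- product is concatenation and γ is the monoid morphism a ↦ aca, b ↦ cab, c ↦ b.
-- Writing σ w = γ(ca w), we have γ(aca) = aca·γ(ca), hence σ(x aca y) = σ x aca σ y;
-- applying σ to the recurrence (i) for k yields it for k + 1. Palindromicity (ii)
-- follows from the shape x aca y aca x of (i). For (iii), the reversal of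
-- p_{k-1} aca p_k is p_k aca p_{k-1}, and σ maps the pair (p_{k-1} aca p_k, p_k aca p_{k-1})
-- to the next one; σ is injective because the images of a, b, c begin with
-- distinct letters, so the two words stay distinct once they differ for k = 0.
module Submission where

open import Defs
open import Data.Nat using (ℕ; zero; suc)
open import Data.Bool using (true)
open import Data.List using (List; []; _∷_; _++_; reverse; map; concatMap; drop)
open import Data.List.Properties
  using (map-++; ++-assoc; ++-cancelˡ; reverse-++; reverse-map; map-injective;
         concatMap-++; concatMap-map; concatMap-cong; map-concatMap)
open import Data.Product using (_×_; _,_; proj₁)
open import Data.Product.Properties using (,-injectiveˡ)
open import Function using (_∘′_)
open import Relation.Nullary using (¬_)
open import Relation.Binary.PropositionalEquality
open ≡-Reasoning

pos : List Letter → Word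
pos = map (_, true)

pos-injective : ∀ {x y} → pos x ≡ pos y → x ≡ y
pos-injective = map-injective ,-injectiveˡ

push-pos : ∀ x w → push (x , true) (pos w) ≡ pos (x ∷ w)
push-pos x []      = refl
push-pos a (a ∷ w) = refl
push-pos a (b ∷ w) = refl
push-pos a (c ∷ w) = refl
push-pos b (a ∷ w) = refl
push-pos b (b ∷ w) = refl
push-pos b (c ∷ w) = refl
push-pos c (a ∷ w) = refl
push-pos c (b ∷ w) = refl
push-pos c (c ∷ w) = refl

reduce-pos : ∀ w → reduce (pos w) ≡ pos w
reduce-pos []      = refl
reduce-pos (x ∷ w) = trans (cong (push (x , true)) (reduce-pos w)) (push-pos x w)

·-pos : ∀ x y → pos x · pos y ≡ pos (x ++ y)
·-pos x y = trans (cong reduce (sym (map-++ _ x y))) (reduce-pos (x ++ y))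

aca⁺ : List Letter
aca⁺ = a ∷ c ∷ a ∷ []

·aca·-pos : ∀ x y → pos x · aca · pos y ≡ pos (x ++ aca⁺ ++ y)
·aca·-pos x y = begin
  pos x · aca · pos y       ≡⟨ cong (_· pos y) (·-pos x aca⁺) ⟩
  pos (x ++ aca⁺) · pos y   ≡⟨ ·-pos (x ++ aca⁺) y ⟩
  pos ((x ++ aca⁺) ++ y)    ≡⟨ cong pos (++-assoc x aca⁺ y) ⟩
  pos (x ++ aca⁺ ++ y)      ∎

reverse-pos : ∀ x → reverse (pos x) ≡ pos (reverse x)
reverse-pos x = sym (reverse-map _ x)

palindrome-pos⁺ : ∀ {x} → reverse x ≡ x → Palindrome (pos x)
palindrome-pos⁺ {x} pal = trans (reverse-pos x) (cong pos pal)

palindrome-pos⁻ : ∀ {x} → Palindrome (pos x) → reverse x ≡ x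
palindrome-pos⁻ {x} pal = pos-injective (trans (sym (reverse-pos x)) pal)

γᴸ : Letter → List Letter
γᴸ a = a ∷ c ∷ a ∷ []
γᴸ b = c ∷ a ∷ b ∷ []
γᴸ c = b ∷ []

γ⁺ : List Letter → List Letter
γ⁺ = concatMap γᴸ

γ-pos : ∀ w → γ (pos w) ≡ pos (γ⁺ w)
γ-pos w = begin
  reduce (concatMap γsym (pos w))          ≡⟨ cong reduce (concatMap-map γsym (_, true) w) ⟩
  reduce (concatMap (γsym ∘′ (_, true)) w) ≡⟨ cong reduce (concatMap-cong γsym-pos w) ⟩
  reduce (concatMap (pos ∘′ γᴸ) w)         ≡⟨ cong reduce (sym (map-concatMap _ γᴸ w)) ⟩
  reduce (pos (γ⁺ w))                      ≡⟨ reduce-pos (γ⁺ w) ⟩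
  pos (γ⁺ w)                               ∎
  where
  γsym-pos : ∀ x → γsym (x , true) ≡ pos (γᴸ x)
  γsym-pos a = refl
  γsym-pos b = refl
  γsym-pos c = refl

γᴸ-prefixInjective : ∀ x y {u v} → γᴸ x ++ u ≡ γᴸ y ++ v → x ≡ y
γᴸ-prefixInjective a a _ = refl
γᴸ-prefixInjective b b _ = refl
γᴸ-prefixInjective c c _ = refl
γᴸ-prefixInjective a b ()
γᴸ-prefixInjective a c ()
γᴸ-prefixInjective b a ()
γᴸ-prefixInjective b c ()
γᴸ-prefixInjective c a ()
γᴸ-prefixInjective c b ()

γ⁺-injective : ∀ {xs ys} → γ⁺ xs ≡ γ⁺ ys → xs ≡ ys
γ⁺-injective {[]}    {[]}    _ = refl
γ⁺-injective {[]}    {a ∷ _} ()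
γ⁺-injective {[]}    {b ∷ _} ()
γ⁺-injective {[]}    {c ∷ _} ()
γ⁺-injective {a ∷ _} {[]}    ()
γ⁺-injective {b ∷ _} {[]}    ()
γ⁺-injective {c ∷ _} {[]}    ()
γ⁺-injective {x ∷ xs} {y ∷ ys} e with refl ← γᴸ-prefixInjective x y e =
  cong (x ∷_) (γ⁺-injective (++-cancelˡ (γᴸ x) (γ⁺ xs) (γ⁺ ys) e))

σ : List Letter → List Letter
σ w = γ⁺ (c ∷ a ∷ w)

σ-injective : ∀ {x y} → σ x ≡ σ y → x ≡ y
σ-injective e = γ⁺-injective (cong (drop 4) e)

-- γ(aca) = aca · γ(ca)
σ-aca : ∀ x y → σ (x ++ aca⁺ ++ y) ≡ σ x ++ aca⁺ ++ σ y
σ-aca x y = cong (λ w → b ∷ a ∷ c ∷ a ∷ w) (concatMap-++ γᴸ x (aca⁺ ++ y))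

p⁺ : ℕ → List Letter
p⁺ zero    = b ∷ []
p⁺ (suc k) = σ (p⁺ k)

p≡pos-p⁺ : ∀ k → p k ≡ pos (p⁺ k)
p≡pos-p⁺ zero    = refl
p≡pos-p⁺ (suc k) = begin
  γ (ᶜ · ᵃ · p k)                   ≡⟨ cong (λ w → γ (ᶜ · ᵃ · w)) (p≡pos-p⁺ k) ⟩
  γ (pos (c ∷ a ∷ []) · pos (p⁺ k)) ≡⟨ cong γ (·-pos (c ∷ a ∷ []) (p⁺ k)) ⟩
  γ (pos (c ∷ a ∷ p⁺ k))            ≡⟨ γ-pos (c ∷ a ∷ p⁺ k) ⟩
  pos (p⁺ (suc k))                  ∎

p⁺-recurrence : ∀ k → p⁺ (suc (suc k)) ≡ p⁺ (suc k) ++ aca⁺ ++ p⁺ k ++ aca⁺ ++ p⁺ (suc k)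
p⁺-recurrence zero    = refl
p⁺-recurrence (suc k) = begin
  σ (p⁺ (suc (suc k)))
    ≡⟨ cong σ (p⁺-recurrence k) ⟩
  σ (p⁺ (suc k) ++ aca⁺ ++ p⁺ k ++ aca⁺ ++ p⁺ (suc k))
    ≡⟨ σ-aca (p⁺ (suc k)) (p⁺ k ++ aca⁺ ++ p⁺ (suc k)) ⟩
  σ (p⁺ (suc k)) ++ aca⁺ ++ σ (p⁺ k ++ aca⁺ ++ p⁺ (suc k))
    ≡⟨ cong (λ w → σ (p⁺ (suc k)) ++ aca⁺ ++ w) (σ-aca (p⁺ k) (p⁺ (suc k))) ⟩
  σ (p⁺ (suc k)) ++ aca⁺ ++ σ (p⁺ k) ++ aca⁺ ++ σ (p⁺ (suc k))
    ∎

reverse-sandwich : ∀ {A : Set} {m : List A} → reverse m ≡ m →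
  ∀ x y → reverse (x ++ m ++ y) ≡ reverse y ++ m ++ reverse x
reverse-sandwich {m = m} pal x y = begin
  reverse (x ++ m ++ y)                 ≡⟨ reverse-++ x (m ++ y) ⟩
  reverse (m ++ y) ++ reverse x         ≡⟨ cong (_++ reverse x) (reverse-++ m y) ⟩
  (reverse y ++ reverse m) ++ reverse x ≡⟨ cong (λ w → (reverse y ++ w) ++ reverse x) pal ⟩
  (reverse y ++ m) ++ reverse x         ≡⟨ ++-assoc (reverse y) m (reverse x) ⟩
  reverse y ++ m ++ reverse x           ∎

palindrome-sandwich : ∀ {A : Set} {m x y : List A} → reverse m ≡ m → reverse x ≡ x → reverse y ≡ y →
  reverse (x ++ m ++ y ++ m ++ x) ≡ x ++ m ++ y ++ m ++ x
palindrome-sandwich {m = m} {x} {y} palm palx paly = begin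
  reverse (x ++ m ++ y ++ m ++ x)                 ≡⟨ reverse-sandwich palm x (y ++ m ++ x) ⟩
  reverse (y ++ m ++ x) ++ m ++ reverse x         ≡⟨ cong (_++ m ++ reverse x) (reverse-sandwich palm y x) ⟩
  (reverse x ++ m ++ reverse y) ++ m ++ reverse x ≡⟨ ++-assoc (reverse x) (m ++ reverse y) (m ++ reverse x) ⟩
  reverse x ++ (m ++ reverse y) ++ m ++ reverse x ≡⟨ cong (reverse x ++_) (++-assoc m (reverse y) (m ++ reverse x)) ⟩
  reverse x ++ m ++ reverse y ++ m ++ reverse x   ≡⟨ cong₂ (λ u v → u ++ m ++ v ++ m ++ u) palx paly ⟩
  x ++ m ++ y ++ m ++ x                           ∎

p⁺-palindrome : ∀ k → reverse (p⁺ k) ≡ p⁺ k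
p⁺-palindrome k = proj₁ (palindromePair k)
  where
  palindromePair : ∀ k → reverse (p⁺ k) ≡ p⁺ k × reverse (p⁺ (suc k)) ≡ p⁺ (suc k)
  palindromePair zero    = refl , refl
  palindromePair (suc k) with palindromePair k
  ... | pal₀ , pal₁ = pal₁ , (begin
    reverse (p⁺ (suc (suc k)))
      ≡⟨ cong reverse (p⁺-recurrence k) ⟩
    reverse (p⁺ (suc k) ++ aca⁺ ++ p⁺ k ++ aca⁺ ++ p⁺ (suc k))
      ≡⟨ palindrome-sandwich {m = aca⁺} refl pal₁ pal₀ ⟩
    p⁺ (suc k) ++ aca⁺ ++ p⁺ k ++ aca⁺ ++ p⁺ (suc k)
      ≡⟨ sym (p⁺-recurrence k) ⟩
    p⁺ (suc (suc k))
      ∎)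

p⁺-aca-noncommuting : ∀ k → p⁺ k ++ aca⁺ ++ p⁺ (suc k) ≢ p⁺ (suc k) ++ aca⁺ ++ p⁺ k
p⁺-aca-noncommuting zero    ()
p⁺-aca-noncommuting (suc k) e = p⁺-aca-noncommuting k (σ-injective (begin
  σ (p⁺ k ++ aca⁺ ++ p⁺ (suc k))         ≡⟨ σ-aca (p⁺ k) (p⁺ (suc k)) ⟩
  p⁺ (suc k) ++ aca⁺ ++ p⁺ (suc (suc k)) ≡⟨ e ⟩
  p⁺ (suc (suc k)) ++ aca⁺ ++ p⁺ (suc k) ≡⟨ sym (σ-aca (p⁺ (suc k)) (p⁺ k)) ⟩
  σ (p⁺ (suc k) ++ aca⁺ ++ p⁺ k)         ∎))

p-recurrence : ∀ k → p (suc (suc k)) ≡ p (suc k) · aca · p k · aca · p (suc k)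
p-recurrence k = begin
  p (suc (suc k))                     ≡⟨ p≡pos-p⁺ (suc (suc k)) ⟩
  pos (p⁺ (suc (suc k)))              ≡⟨ cong pos (p⁺-recurrence k) ⟩
  pos (u ++ aca⁺ ++ w ++ aca⁺ ++ u)   ≡⟨ cong pos (sym (++-assoc u (aca⁺ ++ w) (aca⁺ ++ u))) ⟩
  pos ((u ++ aca⁺ ++ w) ++ aca⁺ ++ u) ≡⟨ sym (·aca·-pos (u ++ aca⁺ ++ w) u) ⟩
  pos (u ++ aca⁺ ++ w) · aca · pos u  ≡⟨ cong (λ v → v · aca · pos u) (sym (·aca·-pos u w)) ⟩
  pos u · aca · pos w · aca · pos u   ≡⟨ sym (cong₂ (λ x y → x · aca · y · aca · x) (p≡pos-p⁺ (suc k)) (p≡pos-p⁺ k)) ⟩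
  p (suc k) · aca · p k · aca · p (suc k) ∎
  where
  u w : List Letter
  u = p⁺ (suc k)
  w = p⁺ k

p-palindrome : ∀ k → Palindrome (p k)
p-palindrome k = subst Palindrome (sym (p≡pos-p⁺ k)) (palindrome-pos⁺ (p⁺-palindrome k))

p-aca-notPalindrome : ∀ k → ¬ Palindrome (p k · aca · p (suc k))
p-aca-notPalindrome k pal = p⁺-aca-noncommuting k (sym (begin
  u ++ aca⁺ ++ w                 ≡⟨ sym (cong₂ (λ x y → x ++ aca⁺ ++ y) (p⁺-palindrome (suc k)) (p⁺-palindrome k)) ⟩
  reverse u ++ aca⁺ ++ reverse w ≡⟨ sym (reverse-sandwich refl w u) ⟩
  reverse (w ++ aca⁺ ++ u)       ≡⟨ palindrome-pos⁻ (subst Palindrome asPos pal) ⟩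
  w ++ aca⁺ ++ u                 ∎))
  where
  u w : List Letter
  u = p⁺ (suc k)
  w = p⁺ k
  asPos : p k · aca · p (suc k) ≡ pos (w ++ aca⁺ ++ u)
  asPos = trans (cong₂ (λ x y → x · aca · y) (p≡pos-p⁺ k) (p≡pos-p⁺ (suc k))) (·aca·-pos w u)

mainTheorem4 : (k : ℕ) →
    (p (suc k) ≡ p k · aca · pPrev k · aca · p k)
    × Palindrome (p k)
    × ¬ Palindrome (pPrev k · aca · p k)
mainTheorem4 zero    = refl , p-palindrome zero , λ ()
mainTheorem4 (suc k) = p-recurrence k , p-palindrome (suc k) , p-aca-notPalindrome k
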